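{- Let $w\in S_n$ be Grassmannian. Then: (I) the shape $\lambda(w)$ is a Young diagram in French notation (rows weakly decrease in length from bottom to top, all left-justified); (II) if $T$ is a minimal prism tableau for $w$, then all labels in any given box of $T$ have the same value; (III) no minimal prism tableau for $w$ has an unstable triple; i.e. the set of minimal prism tableaux for $w$ equals $\mathtt{Prism}(w)$.
   Context: $w$ is Grassmannian if it has at most one descent (index $k$ with $w(k)>w(k+1)$). $\ell(w)$ is the Coxeter length. Boxes are indexed $(i,j)$ in matrix coordinates (row $i$ from the top). The diagram is $D(w)=\{(i,j): w(i)>j,\ w^{ -1}(j)>i\}$; the essential set $\mathcal{E}ss(w)$ consists of $(i,j)\in D(w)$ with $(i+1,j),(i,j+1)\notin D(w)$; $r_w(i,j)=\#\{t\le i: w(t)\le j\}$. For $e=(i,j)\in\mathcal{E}ss(w)$, $R_e$ is the rectangle of rows $r_w(i,j)+1,\ldots,i$ and columns $1,\ldots,j-r_w(i,j)$; $\lambda(w)=\bigcup_e R_e$. A prism tableau $T$ for $w$ assigns to each $e\in\mathcal{E}ss(w)$ (a color) a filling of the boxes of $R_e$ by positive integers (exactly one label of color $e$ per box of $R_e$, none outside), such that for each color the labels weakly decrease along rows left to right, strictly increase down columns, and each label is at most the row index of its box. The $i$-th antidiagonal is $\{(a,b):a+b=i+1\}$; $d_i$ is the number of distinct values (ignoring color) of labels in it; $T$ is minimal if $\sum_{i=1}^n d_i=\ell(w)$. Writing $\ell_c$ for a label of value $\ell$ and color $c$, three distinct labels $\ell_c,\ell_d,\ell'_e$ in the same antidiagonal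 form an unstable triple if $\ell<\ell'$ and replacing $\ell_c$ by $\ell'_c$ (same box and color) gives a prism tableau. $\mathtt{Prism}(w)$ is the set of minimal prism tableaux with no unstable triple. -}

module Defs where

open import Data.Nat using (ℕ; zero; suc; _+_; _∸_; _≤_; _<_; _≤?_; _<?_)
open import Data.Nat.Properties using (_≟_)
open import Data.Fin using (Fin; toℕ; fromℕ<)
open import Data.Fin.Permutation using (Permutation′; _⟨$⟩ʳ_; _⟨$⟩ˡ_)
open import Data.Product using (Σ; ∃; _×_; _,_; proj₁; proj₂)
open import Data.Product.Properties using (≡-dec)
open import Data.List using (List; map; upTo; length; filter; concatMap; cartesianProduct; deduplicate)
open import Data.Nat.ListAction using (sum)
open import Data.Bool using (if_then_else_)
open import Relation.Nullary using (¬_; Dec; yes; no; does; _×-dec_; ¬?)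
open import Relation.Binary.PropositionalEquality using (_≡_; _≢_)

-- Positions (rows / columns / one-line values) are 1-based natural numbers.
-- A permutation w ∈ S_n is a library permutation of Fin n; we read it as a
-- function on {1..n}, returning 0 outside {1..n} (never used there).

module _ {n : ℕ} (w : Permutation′ n) where

  app : ℕ → ℕ
  app zero = 0
  app (suc k) with k <? n
  ... | yes p = suc (toℕ (w ⟨$⟩ʳ fromℕ< p))
  ... | no _  = 0

  appInv : ℕ → ℕ
  appInv zero = 0
  appInv (suc k) with k <? n
  ... | yes p = suc (toℕ (w ⟨$⟩ˡ fromℕ< p))
  ... | no _  = 0

range : ℕ → List ℕ
range m = map suc (upTo m)

Box : Set
Box = ℕ × ℕ

-- colors are essential boxes, i.e. boxes
Color : Set
Color = Box

module _ {n : ℕ} (w : Permutation′ n) where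

  allBoxes : List Box
  allBoxes = cartesianProduct (range n) (range n)

  Descent : ℕ → Set
  Descent k = (1 ≤ k) × (suc k ≤ n) × (app w (suc k) < app w k)

  Grassmannian : Set
  Grassmannian = ∀ k k' → Descent k → Descent k' → k ≡ k'

  inv? : (x : Box) → Dec ((proj₁ x < proj₂ x) × (app w (proj₂ x) < app w (proj₁ x)))
  inv? (i , j) = (i <? j) ×-dec (app w j <? app w i)

  len : ℕ
  len = length (filter inv? allBoxes)

  InD : Box → Set
  InD (i , j) = (j < app w i) × (i < appInv w j)

  InD? : (x : Box) → Dec (InD x)
  InD? (i , j) = (j <? app w i) ×-dec (i <? appInv w j)

  Ess : Box → Set
  Ess (i , j) = InD (i , j) × ¬ InD (suc i , j) × ¬ InD (i , suc j)

  Ess? : (x : Box) → Dec (Ess x)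
  Ess? (i , j) = InD? (i , j) ×-dec (¬? (InD? (suc i , j)) ×-dec ¬? (InD? (i , suc j)))

  rank : Box → ℕ
  rank (i , j) = length (filter (λ t → app w t ≤? j) (range i))

  InR : Color → Box → Set
  InR (i , j) (a , b) = (suc (rank (i , j)) ≤ a) × (a ≤ i) × (1 ≤ b) × (b ≤ j ∸ rank (i , j))

  InR? : (e : Color) (x : Box) → Dec (InR e x)
  InR? (i , j) (a , b) =
    (suc (rank (i , j)) ≤? a) ×-dec ((a ≤? i) ×-dec ((1 ≤? b) ×-dec (b ≤? j ∸ rank (i , j))))

  InLambda : Box → Set
  InLambda x = Σ Color λ e → Ess e × InR e x

-- A shape (set of boxes) is a Young diagram in French notation: rows are
-- left-justified, and going down (increasing row index) between two rows of the
-- shape every row contains every column that a row above it contains; i.e. the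
-- nonempty rows are consecutive and their lengths weakly decrease from bottom to top.
FrenchYoung : (Box → Set) → Set
FrenchYoung S =
  (∀ a b → S (a , b) → 1 ≤ b) ×
  (∀ a b b' → S (a , b) → 1 ≤ b' → b' ≤ b → S (a , b')) ×
  (∀ a a' a'' b b'' → S (a , b) → S (a'' , b'') → a ≤ a' → a' ≤ a'' → S (a' , b))

-- A (colored) tableau: T e x is the label of color e in box x
-- (only meaningful for e essential and x ∈ R_e).
Tableau : Set
Tableau = Color → Box → ℕ

module _ {n : ℕ} (w : Permutation′ n) where

  IsPrism : Tableau → Set
  IsPrism T = ∀ e → Ess w e → ∀ a b → InR w e (a , b) →
      (1 ≤ T e (a , b))
    × (T e (a , b) ≤ a)
    × (InR w e (a , suc b) → T e (a , suc b) ≤ T e (a , b))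
    × (InR w e (suc a , b) → T e (a , b) < T e (suc a , b))

  antiLabels : Tableau → ℕ → List ℕ
  antiLabels T i =
    concatMap (λ e → map (T e)
                  (filter (λ x → InR? w e x ×-dec (proj₁ x + proj₂ x ≟ suc i)) (allBoxes w)))
              (filter (Ess? w) (allBoxes w))

  d : Tableau → ℕ → ℕ
  d T i = length (deduplicate _≟_ (antiLabels T i))

  IsMinimal : Tableau → Set
  IsMinimal T = sum (map (d T) (range n)) ≡ len w

  MinimalPrism : Tableau → Set
  MinimalPrism T = IsPrism T × IsMinimal T

  Label : Set
  Label = Color × Box

  ValidLabel : Label → Set
  ValidLabel (e , x) = Ess w e × InR w e x

  antidiag : Label → ℕ
  antidiag (e , (a , b)) = a + b

  val : Tableau → Label → ℕ
  val T (e , x) = T e x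

  update : Tableau → Label → ℕ → Tableau
  update T (e , x) v e' x' =
    if does (≡-dec (≡-dec _≟_ _≟_) (≡-dec _≟_ _≟_) (e' , x') (e , x)) then v else T e' x'

  UnstableTriple : Tableau → Label → Label → Label → Set
  UnstableTriple T p q r =
    ValidLabel p × ValidLabel q × ValidLabel r ×
    (p ≢ q) × (p ≢ r) × (q ≢ r) ×
    (antidiag p ≡ antidiag q) × (antidiag p ≡ antidiag r) ×
    (val T p ≡ val T q) × (val T p < val T r) ×
    IsPrism (update T p (val T r))

  HasUnstableTriple : Tableau → Set
  HasUnstableTriple T = Σ Label λ p → Σ Label λ q → Σ Label λ r → UnstableTriple T p q r

  InPrism : Tableau → Set
  InPrism T = MinimalPrism T × ¬ HasUnstableTriple T

  SameValuesInBoxes : Tableau → Set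
  SameValuesInBoxes T = ∀ e e' x → Ess w e → Ess w e' → InR w e x → InR w e' x → T e x ≡ T e' x

{-# OPTIONS --safe #-}
module Submission where

-- Let k be the descent of w (without one there are no essential boxes). Every essential box
-- lies in row k, so the rectangles R_e all end in row k and start in column 1; this gives (I), and
-- λ(w) turns out to be the diagram whose row a ≤ k has w(a) − a boxes.
--
-- Counting inversions row by row gives ℓ(w) ≤ Σᵢ Lᵢ, where Lᵢ is the number of boxes of λ(w) on
-- the i-th antidiagonal. The rectangle of the topmost such box covers the whole antidiagonal, and
-- its labels strictly increase down the antidiagonal, so dᵢ ≥ Lᵢ. Minimality forces dᵢ = Lᵢ:
-- every label on the antidiagonal is a label of the covering color. Comparing positions along the
-- antidiagonal bounds each label by the covering label in its box; the reverse bound follows by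
-- induction from the top-right corner of each rectangle. So all labels in a box agree (II), and
-- an unstable triple would force a label to equal one further down the same antidiagonal of the
-- same color, which strict increase forbids (III).

open import Algebra.Properties.CommutativeSemigroup using (x∙yz≈y∙xz)
open import Data.Bool using (true; false; if_then_else_)
open import Data.Empty using (⊥)
open import Data.Fin using (toℕ; fromℕ<)
open import Data.Fin.Permutation using (Permutation′; flip; _⟨$⟩ʳ_; _⟨$⟩ˡ_; inverseˡ)
open import Data.Fin.Properties using (toℕ<n; fromℕ<-toℕ; toℕ-fromℕ<)
open import Data.List using (List; []; _∷_; _++_; map; upTo; length; filter; cartesianProduct; deduplicate)
open import Data.List.Membership.Propositional using (_∈_; lose)
open import Data.List.Membership.Propositional.Properties
  using ( ∈-filter⁺; ∈-filter⁻; ∈-map⁺; ∈-map⁻; ∈-upTo⁺; ∈-upTo⁻; ∈-++⁻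
        ; ∈-concatMap⁺; ∈-cartesianProduct⁺; ∈-deduplicate⁺)
open import Data.List.Properties using (length-map; length-upTo; length-++; filter-notAll; filter-++)
open import Data.List.Relation.Binary.Disjoint.Propositional using (Disjoint)
open import Data.List.Relation.Binary.Subset.Propositional using (_⊆_)
import Data.List.Relation.Unary.All as All
open import Data.List.Relation.Unary.AllPairs using ([]; _∷_)
open import Data.List.Relation.Unary.Any as Any using (Any; here; there)
open import Data.List.Relation.Unary.Unique.Propositional using (Unique)
import Data.List.Relation.Unary.Unique.Propositional.Properties as Unique
open import Data.Nat using (ℕ; zero; suc; pred; >-nonZero; _+_; _∸_; _≤_; _<_; _≤?_; _<?_; z≤n; s≤s)
open import Data.Nat.Induction using (<-wellFounded)
open import Data.Nat.ListAction using (sum)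
open import Data.Nat.Properties
open import Data.Product using (∃-syntax; _×_; _,_; proj₁; proj₂)
open import Data.Product.Properties using (≡-dec)
open import Data.Sum using (inj₁; inj₂)
open import Function using (_∘′_; case_of_)
open import Induction.WellFounded using (Acc; acc)
open import Relation.Binary.Definitions using (DecidableEquality; tri<; tri≈; tri>)
open import Relation.Binary.PropositionalEquality
open import Relation.Nullary using (¬_; Dec; yes; no; ¬?; does; contradiction; _×-dec_)
open import Relation.Nullary.Decidable using (dec-true; dec-false)
open import Relation.Unary using (Pred; Decidable)
open import Defs

module _ {a} {A : Set a} (_≟_ : DecidableEquality A) where

  open import Data.List.Membership.DecPropositional _≟_ using (_∈?_)

  Unique-⊆⇒length≤ : ∀ {xs ys : List A} → Unique xs → xs ⊆ ys → length xs ≤ length ys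
  Unique-⊆⇒length≤ {[]}     _          _       = z≤n
  Unique-⊆⇒length≤ {x ∷ xs} {ys} (x∉xs ∷ u) x∷xs⊆ys = begin-strict
    length xs                             ≤⟨ Unique-⊆⇒length≤ u xs⊆ys∖x ⟩
    length (filter (λ y → ¬? (y ≟ x)) ys) <⟨ filter-notAll _ ys x∈ys ⟩
    length ys                             ∎
    where
      open ≤-Reasoning
      x∈ys : Any (λ y → ¬ (y ≢ x)) ys
      x∈ys = Any.map (λ { refl y≢y → y≢y refl }) (x∷xs⊆ys (here refl))
      xs⊆ys∖x : xs ⊆ filter (λ y → ¬? (y ≟ x)) ys
      xs⊆ys∖x z∈xs = ∈-filter⁺ _ (x∷xs⊆ys (there z∈xs)) (λ z≡x → All.lookup x∉xs z∈xs (sym z≡x))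

  Unique-⊆-length≥⇒⊇ : ∀ {xs ys : List A} → Unique xs → xs ⊆ ys → length ys ≤ length xs → ys ⊆ xs
  Unique-⊆-length≥⇒⊇ {xs} {ys} u xs⊆ys |ys|≤|xs| {y} y∈ys with y ∈? xs
  ... | yes y∈xs = y∈xs
  ... | no  y∉xs = contradiction (Unique-⊆⇒length≤ (y≢xs ∷ u) y∷xs⊆ys) (<⇒≱ (s≤s |ys|≤|xs|))
    where
      y≢xs : All.All (y ≢_) xs
      y≢xs = All.tabulate λ z∈xs y≡z → y∉xs (subst (_∈ xs) (sym y≡z) z∈xs)
      y∷xs⊆ys : y ∷ xs ⊆ ys
      y∷xs⊆ys (here refl)  = y∈ys
      y∷xs⊆ys (there z∈xs) = xs⊆ys z∈xs

Unique-map-injectiveOn : ∀ {a b} {A : Set a} {B : Set b} (f : A → B) {xs : List A} →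
  (∀ {x y} → x ∈ xs → y ∈ xs → f x ≡ f y → x ≡ y) → Unique xs → Unique (map f xs)
Unique-map-injectiveOn f {[]}     _   []         = []
Unique-map-injectiveOn f {x ∷ xs} inj (x∉xs ∷ u) =
  All.tabulate fx≢ ∷ Unique-map-injectiveOn f (λ p q → inj (there p) (there q)) u
  where
    fx≢ : ∀ {v} → v ∈ map f xs → f x ≢ v
    fx≢ v∈ fx≡v with ∈-map⁻ f v∈
    ... | y , y∈xs , refl = All.lookup x∉xs y∈xs (inj (here refl) (there y∈xs) fx≡v)

length-filter-map : ∀ {a b p} {A : Set a} {B : Set b} {P : Pred B p} (P? : Decidable P) (f : A → B) xs →
  length (filter P? (map f xs)) ≡ length (filter (λ x → P? (f x)) xs)
length-filter-map P? f []       = refl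
length-filter-map P? f (x ∷ xs) with does (P? (f x))
... | true  = cong suc (length-filter-map P? f xs)
... | false = length-filter-map P? f xs

module _ {a} {A : Set a} where

  sum-map-mono-≤ : ∀ (f g : A → ℕ) xs → (∀ {x} → x ∈ xs → f x ≤ g x) → sum (map f xs) ≤ sum (map g xs)
  sum-map-mono-≤ f g []       _   = z≤n
  sum-map-mono-≤ f g (x ∷ xs) f≤g = +-mono-≤ (f≤g (here refl)) (sum-map-mono-≤ f g xs (f≤g ∘′ there))

  sum-map-≥⇒pointwise-≡ : ∀ (f g : A → ℕ) xs → (∀ {x} → x ∈ xs → f x ≤ g x) →
    sum (map g xs) ≤ sum (map f xs) → ∀ {x} → x ∈ xs → f x ≡ g x
  sum-map-≥⇒pointwise-≡ f g (x ∷ xs) f≤g Σg≤Σf (here refl) =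
    ≤-antisym (f≤g (here refl))
      (+-cancelʳ-≤ (sum (map g xs)) (g x) (f x)
        (≤-trans Σg≤Σf (+-monoʳ-≤ (f x) (sum-map-mono-≤ f g xs (f≤g ∘′ there)))))
  sum-map-≥⇒pointwise-≡ f g (x ∷ xs) f≤g Σg≤Σf (there x′∈xs) =
    sum-map-≥⇒pointwise-≡ f g xs (f≤g ∘′ there)
      (+-cancelˡ-≤ (f x) _ _ (≤-trans (+-monoˡ-≤ _ (f≤g (here refl))) Σg≤Σf)) x′∈xs

  length-filter-cartesianProduct : ∀ {b p} {B : Set b} {P : Pred (A × B) p} (P? : Decidable P) xs ys →
    length (filter P? (cartesianProduct xs ys)) ≡ sum (map (λ x → length (filter (λ y → P? (x , y)) ys)) xs)
  length-filter-cartesianProduct P? []       ys = refl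
  length-filter-cartesianProduct P? (x ∷ xs) ys = begin
    length (filter P? (map (x ,_) ys ++ cartesianProduct xs ys))
      ≡⟨ cong length (filter-++ P? (map (x ,_) ys) _) ⟩
    length (filter P? (map (x ,_) ys) ++ filter P? (cartesianProduct xs ys))
      ≡⟨ length-++ (filter P? (map (x ,_) ys)) ⟩
    length (filter P? (map (x ,_) ys)) + length (filter P? (cartesianProduct xs ys))
      ≡⟨ cong₂ _+_ (length-filter-map P? (x ,_) ys) (length-filter-cartesianProduct P? xs ys) ⟩
    length (filter (λ y → P? (x , y)) ys) + sum (map (λ x → length (filter (λ y → P? (x , y)) ys)) xs)
      ∎
    where open ≡-Reasoning

  sum-length-filter-comm : ∀ {b q} {B : Set b} {Q : A → B → Set q} (Q? : ∀ x y → Dec (Q x y)) xs ys →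
    sum (map (λ x → length (filter (Q? x) ys)) xs) ≡ sum (map (λ y → length (filter (λ x → Q? x y) xs)) ys)
  sum-length-filter-comm Q? []       ys = sym (sum-zeros ys)
    where
      sum-zeros : ∀ ys → sum (map (λ _ → 0) ys) ≡ 0
      sum-zeros []       = refl
      sum-zeros (_ ∷ ys) = sum-zeros ys
  sum-length-filter-comm Q? (x ∷ xs) ys =
    trans (cong (length (filter (Q? x) ys) +_) (sum-length-filter-comm Q? xs ys)) (add-row ys)
    where
      column : _ → ℕ
      column y = length (filter (λ x′ → Q? x′ y) xs)
      swap-front : ∀ y ys → length (filter (Q? x) ys) + (column y + sum (map column ys))
                          ≡ column y + (length (filter (Q? x) ys) + sum (map column ys))
      swap-front y ys =
        x∙yz≈y∙xz +-commutativeSemigroup (length (filter (Q? x) ys)) (column y) (sum (map column ys))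
      add-row : ∀ ys → length (filter (Q? x) ys) + sum (map column ys)
                     ≡ sum (map (λ y → length (filter (λ x′ → Q? x′ y) (x ∷ xs))) ys)
      add-row []       = refl
      add-row (y ∷ ys) with does (Q? x y)
      ... | true  = cong suc (trans (swap-front y ys) (cong (column y +_) (add-row ys)))
      ... | false = trans (swap-front y ys) (cong (column y +_) (add-row ys))

∈-range⁻ : ∀ {m x} → x ∈ range m → 1 ≤ x × x ≤ m
∈-range⁻ x∈ with ∈-map⁻ suc x∈
... | y , y∈ , refl = s≤s z≤n , ∈-upTo⁻ y∈

∈-range⁺ : ∀ {m x} → 1 ≤ x → x ≤ m → x ∈ range m
∈-range⁺ {x = suc x} _ x<m = ∈-map⁺ suc (∈-upTo⁺ x<m)

range-Unique : ∀ m → Unique (range m)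
range-Unique m = Unique.map⁺ suc-injective (Unique.upTo⁺ m)

length-range : ∀ m → length (range m) ≡ m
length-range m = trans (length-map suc (upTo m)) (length-upTo m)

module _ {p} {P : Pred ℕ p} (P? : Decidable P) where

  length-filter-range-≥ : ∀ {m K} → m ≤ K → (∀ {t} → 1 ≤ t → t ≤ m → P t) → m ≤ length (filter P? (range K))
  length-filter-range-≥ {m} m≤K P-upto-m = subst (_≤ _) (length-range m)
    (Unique-⊆⇒length≤ _≟_ (range-Unique m)
      (λ t∈ → let 1≤t , t≤m = ∈-range⁻ t∈ in ∈-filter⁺ P? (∈-range⁺ 1≤t (≤-trans t≤m m≤K)) (P-upto-m 1≤t t≤m)))

  length-filter-range-≤ : ∀ {m K} → (∀ {t} → 1 ≤ t → t ≤ K → P t → t ≤ m) → length (filter P? (range K)) ≤ m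
  length-filter-range-≤ {m} {K} P⇒≤m = subst (_ ≤_) (length-range m)
    (Unique-⊆⇒length≤ _≟_ (Unique.filter⁺ P? (range-Unique K))
      (λ t∈ → let t∈K , Pt = ∈-filter⁻ P? t∈ ; 1≤t , t≤K = ∈-range⁻ t∈K in ∈-range⁺ 1≤t (P⇒≤m 1≤t t≤K Pt)))

≤∸⇒+≤ : ∀ {b j r} → 1 ≤ b → b ≤ j ∸ r → b + r ≤ j
≤∸⇒+≤ {b} {j} {r} 1≤b b≤j∸r = m≤o∸n⇒m+n≤o b (<⇒≤ (m∸n≢0⇒n<m j∸r≢0)) b≤j∸r
  where
    j∸r≢0 : j ∸ r ≢ 0
    j∸r≢0 j∸r≡0 = contradiction (≤-trans 1≤b (subst (b ≤_) j∸r≡0 b≤j∸r)) λ ()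

+≡+∧≤⇒≥ : ∀ {a b a′ b′} → a + b ≡ a′ + b′ → a ≤ a′ → b′ ≤ b
+≡+∧≤⇒≥ {a} {b} {a′} {b′} a+b≡a′+b′ a≤a′ =
  +-cancelˡ-≤ a b′ b (≤-trans (+-monoˡ-≤ b′ a≤a′) (≤-reflexive (sym a+b≡a′+b′)))

module _ (f : ℕ → ℕ) {lo hi : ℕ} (ascent : ∀ {t} → lo ≤ t → suc t ≤ hi → f t < f (suc t)) where

  ascents⇒+-mono : ∀ {s t} → lo ≤ s → s ≤ t → t ≤ hi → f s + t ≤ f t + s
  ascents⇒+-mono {t = zero} _ z≤n _ = ≤-refl
  ascents⇒+-mono {s} {suc t} lo≤s s≤1+t 1+t≤hi with m≤n⇒m<n∨m≡n s≤1+t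
  ... | inj₂ refl  = ≤-refl
  ... | inj₁ s<1+t = begin
    f s + suc t   ≡⟨ +-suc (f s) t ⟩
    suc (f s + t) ≤⟨ s≤s (ascents⇒+-mono lo≤s s≤t (<⇒≤ 1+t≤hi)) ⟩
    suc (f t + s) ≤⟨ +-monoˡ-≤ s (ascent (≤-trans lo≤s s≤t) 1+t≤hi) ⟩
    f (suc t) + s ∎
    where
      open ≤-Reasoning
      s≤t : s ≤ t
      s≤t = ≤-pred s<1+t

  ascents⇒< : ∀ {s t} → lo ≤ s → s < t → t ≤ hi → f s < f t
  ascents⇒< {s} {t} lo≤s s<t t≤hi = +-cancelʳ-< t (f s) (f t)
    (≤-<-trans (ascents⇒+-mono lo≤s (<⇒≤ s<t) t≤hi) (+-monoʳ-< (f t) s<t))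

  ascents⇒≤ : ∀ {s t} → lo ≤ s → s ≤ t → t ≤ hi → f s ≤ f t
  ascents⇒≤ {s} {t} lo≤s s≤t t≤hi = +-cancelʳ-≤ t (f s) (f t)
    (≤-trans (ascents⇒+-mono lo≤s s≤t t≤hi) (+-monoʳ-≤ (f t) s≤t))

module _ {n : ℕ} (w : Permutation′ n) where

  app-bounded : ∀ {t} → 1 ≤ t → t ≤ n → 1 ≤ app w t × app w t ≤ n
  app-bounded {suc t} _ t<n with t <? n
  ... | yes t<n′ = s≤s z≤n , toℕ<n (w ⟨$⟩ʳ fromℕ< t<n′)
  ... | no  t≮n  = contradiction t<n t≮n

  app≤n : ∀ t → app w t ≤ n
  app≤n zero    = z≤n
  app≤n (suc t) with t <? n
  ... | yes t<n = toℕ<n (w ⟨$⟩ʳ fromℕ< t<n)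
  ... | no  _   = z≤n

  app-positive⇒bounded : ∀ {t} → 1 ≤ app w t → 1 ≤ t × t ≤ n
  app-positive⇒bounded {suc t} 1≤w[t] with t <? n
  ... | yes t<n = s≤s z≤n , t<n
  ... | no  _   = contradiction 1≤w[t] λ ()

  app-flip-app : ∀ {t} → 1 ≤ t → t ≤ n → app (flip w) (app w t) ≡ t
  app-flip-app {suc t} _ t<n with t <? n
  ... | no  t≮n  = contradiction t<n t≮n
  ... | yes t<n′ with toℕ (w ⟨$⟩ʳ fromℕ< t<n′) <? n
  ...   | no  w[t]≮n = contradiction (toℕ<n _) w[t]≮n
  ...   | yes w[t]<n = cong suc (begin
    toℕ (w ⟨$⟩ˡ fromℕ< w[t]<n)        ≡⟨ cong (λ i → toℕ (w ⟨$⟩ˡ i)) (fromℕ<-toℕ _ w[t]<n) ⟩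
    toℕ (w ⟨$⟩ˡ (w ⟨$⟩ʳ fromℕ< t<n′)) ≡⟨ cong toℕ (inverseˡ w) ⟩
    toℕ (fromℕ< t<n′)                 ≡⟨ toℕ-fromℕ< t<n′ ⟩
    t                                 ∎)
    where open ≡-Reasoning

-- Properties of appInv are obtained from those of app, since flip (flip w) is definitionally w.
appInv≗app-flip : ∀ {n} (w : Permutation′ n) t → appInv w t ≡ app (flip w) t
appInv≗app-flip         w zero    = refl
appInv≗app-flip {n = n} w (suc t) with t <? n
... | yes _ = refl
... | no  _ = refl

module _ {n : ℕ} (w : Permutation′ n) where

  appInv-bounded : ∀ {j} → 1 ≤ j → j ≤ n → 1 ≤ appInv w j × appInv w j ≤ n
  appInv-bounded {j} rewrite appInv≗app-flip w j = app-bounded (flip w)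

  appInv≤n : ∀ j → appInv w j ≤ n
  appInv≤n j rewrite appInv≗app-flip w j = app≤n (flip w) j

  appInv-positive⇒bounded : ∀ {j} → 1 ≤ appInv w j → 1 ≤ j × j ≤ n
  appInv-positive⇒bounded {j} rewrite appInv≗app-flip w j = app-positive⇒bounded (flip w)

  appInv-app : ∀ {t} → 1 ≤ t → t ≤ n → appInv w (app w t) ≡ t
  appInv-app {t} rewrite appInv≗app-flip w (app w t) = app-flip-app w

  app-appInv : ∀ {j} → 1 ≤ j → j ≤ n → app w (appInv w j) ≡ j
  app-appInv {j} rewrite appInv≗app-flip w j = app-flip-app (flip w)

  app-injective : ∀ {s t} → 1 ≤ s → s ≤ n → 1 ≤ t → t ≤ n → app w s ≡ app w t → s ≡ t
  app-injective 1≤s s≤n 1≤t t≤n w[s]≡w[t] =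
    trans (sym (appInv-app 1≤s s≤n)) (trans (cong (appInv w) w[s]≡w[t]) (appInv-app 1≤t t≤n))

  essential⇒descent : ∀ {i j} → Ess w (i , j) → Descent w i
  essential⇒descent {i} {j} ((j<w[i] , i<w⁻¹[j]) , ∉D[1+i,j] , _) =
    proj₁ (app-positive⇒bounded w (≤-trans (s≤s z≤n) j<w[i])) ,
    ≤-trans i<w⁻¹[j] (appInv≤n j) ,
    ≤-<-trans (≮⇒≥ j≮w[1+i]) j<w[i]
    where
      j≮w[1+i] : ¬ j < app w (suc i)
      j≮w[1+i] j<w[1+i] = <-irrefl (sym w[1+i]≡j) j<w[1+i]
        where
          j∈[1,n] : 1 ≤ j × j ≤ n
          j∈[1,n] = appInv-positive⇒bounded (≤-trans (s≤s z≤n) i<w⁻¹[j])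
          w⁻¹[j]≡1+i : appInv w j ≡ suc i
          w⁻¹[j]≡1+i = ≤-antisym (≮⇒≥ λ 1+i<w⁻¹[j] → ∉D[1+i,j] (j<w[1+i] , 1+i<w⁻¹[j])) i<w⁻¹[j]
          w[1+i]≡j : app w (suc i) ≡ j
          w[1+i]≡j = trans (cong (app w) (sym w⁻¹[j]≡1+i)) (app-appInv (proj₁ j∈[1,n]) (proj₂ j∈[1,n]))

InLambda-frenchYoung : ∀ {n} {w : Permutation′ n} → Grassmannian w → FrenchYoung (InLambda w)
InLambda-frenchYoung {w = w} grassmannian =
    (λ { _ _ (_ , _ , _ , _ , 1≤b , _) → 1≤b })
  , (λ { _ _ _ (e , E , r<a , a≤i , _ , b≤c) 1≤b′ b′≤b → e , E , r<a , a≤i , 1≤b′ , ≤-trans b′≤b b≤c })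
  , λ { _ _ _ _ _ (e , E , r<a , _ , R) ((i″ , _) , E″ , _ , a″≤i″ , _) a≤a′ a′≤a″ →
        e , E , <-≤-trans r<a a≤a′ , ≤-trans a′≤a″ (≤-trans a″≤i″ (≤-reflexive (same-row E″ E))) , R }
  where
    same-row : ∀ {i j i′ j′} → Ess w (i , j) → Ess w (i′ , j′) → i ≡ i′
    same-row E E′ = grassmannian _ _ (essential⇒descent w E) (essential⇒descent w E′)

module _ {n : ℕ} {w : Permutation′ n} where

  InR-between : ∀ {e a b a′ b′ a″ b″} → InR w e (a , b) → InR w e (a′ , b′) →
    a ≤ a″ → a″ ≤ a′ → b′ ≤ b″ → b″ ≤ b → InR w e (a″ , b″)
  InR-between (r<a , _ , _ , b≤c) (_ , a′≤i , 1≤b′ , _) a≤a″ a″≤a′ b′≤b″ b″≤b =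
    <-≤-trans r<a a≤a″ , ≤-trans a″≤a′ a′≤i , ≤-trans 1≤b′ b′≤b″ , ≤-trans b″≤b b≤c

  label∈antiLabels : ∀ (T : Tableau) {e a b i} → Ess w e → InR w e (a , b) → a + b ≡ suc i →
    T e (a , b) ∈ antiLabels w T i
  label∈antiLabels T {e@(i′ , j)} {a} {b} {i} E@((j<w[i′] , i′<w⁻¹[j]) , _) R@(r<a , a≤i′ , 1≤b , b≤j∸r) a+b≡1+i =
    ∈-concatMap⁺ _ (lose (∈-filter⁺ (Ess? w) e∈boxes E)
      (∈-map⁺ (T e) (∈-filter⁺ (λ x → InR? w e x ×-dec (proj₁ x + proj₂ x ≟ suc i)) x∈boxes (R , a+b≡1+i))))
    where
      i′∈[1,n] : 1 ≤ i′ × i′ ≤ n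
      i′∈[1,n] = app-positive⇒bounded w (≤-trans (s≤s z≤n) j<w[i′])
      j∈[1,n] : 1 ≤ j × j ≤ n
      j∈[1,n] = appInv-positive⇒bounded w (≤-trans (s≤s z≤n) i′<w⁻¹[j])
      e∈boxes : e ∈ allBoxes w
      e∈boxes = ∈-cartesianProduct⁺ (∈-range⁺ (proj₁ i′∈[1,n]) (proj₂ i′∈[1,n]))
                  (∈-range⁺ (proj₁ j∈[1,n]) (proj₂ j∈[1,n]))
      x∈boxes : (a , b) ∈ allBoxes w
      x∈boxes = ∈-cartesianProduct⁺ (∈-range⁺ (≤-trans (s≤s z≤n) r<a) (≤-trans a≤i′ (proj₂ i′∈[1,n])))
                  (∈-range⁺ 1≤b (≤-trans b≤j∸r (≤-trans (m∸n≤m j (rank w e)) (proj₂ j∈[1,n]))))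

  module _ {T : Tableau} (prism : IsPrism w T) {e : Color} (E : Ess w e) where

    label-≤-row : ∀ {a b} → InR w e (a , b) → InR w e (a , suc b) → T e (a , suc b) ≤ T e (a , b)
    label-≤-row {a} {b} R R→ = proj₁ (proj₂ (proj₂ (prism e E a b R))) R→

    label-<-column : ∀ {a b} → InR w e (a , b) → InR w e (suc a , b) → T e (a , b) < T e (suc a , b)
    label-<-column {a} {b} R R↓ = proj₂ (proj₂ (proj₂ (prism e E a b R))) R↓

    label-antidiagonal-step : ∀ {a b} → InR w e (a , suc b) → InR w e (suc a , b) →
      T e (a , suc b) < T e (suc a , b)
    label-antidiagonal-step {a} {b} R↗ R↙ = ≤-<-trans (label-≤-row R R↗) (label-<-column R R↙)
      where
        R : InR w e (a , b)
        R = InR-between R↗ R↙ ≤-refl (n≤1+n a) ≤-refl (n≤1+n b)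

    label-<-antidiagonal : ∀ {a b a′ b′} → InR w e (a , b) → InR w e (a′ , b′) → a + b ≡ a′ + b′ → a < a′ →
      T e (a , b) < T e (a′ , b′)
    label-<-antidiagonal {a} {suc b} {a′} {b′} R R′ eq a<a′ with m≤n⇒m<n∨m≡n a<a′
    ... | inj₂ refl with +-cancelˡ-≡ a b b′ (suc-injective (trans (sym (+-suc a b)) eq))
    ...   | refl = label-antidiagonal-step R R′
    label-<-antidiagonal {a} {suc b} {a′} {b′} R R′ eq a<a′ | inj₁ 1+a<a′ =
      <-trans (label-antidiagonal-step R R↙) (label-<-antidiagonal R↙ R′ eq′ 1+a<a′)
      where
        eq′ : suc a + b ≡ a′ + b′
        eq′ = trans (sym (+-suc a b)) eq
        R↙ : InR w e (suc a , b)
        R↙ = InR-between R R′ (n≤1+n a) (<⇒≤ 1+a<a′) (+≡+∧≤⇒≥ eq′ (<⇒≤ 1+a<a′)) (n≤1+n b)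

    label-≤-antidiagonal : ∀ {a b a′ b′} → InR w e (a , b) → InR w e (a′ , b′) → a + b ≡ a′ + b′ → a ≤ a′ →
      T e (a , b) ≤ T e (a′ , b′)
    label-≤-antidiagonal {a} {b} {a′} {b′} R R′ eq a≤a′ with m≤n⇒m<n∨m≡n a≤a′
    ... | inj₁ a<a′ = <⇒≤ (label-<-antidiagonal R R′ eq a<a′)
    ... | inj₂ refl with +-cancelˡ-≡ a b b′ eq
    ...   | refl = ≤-refl

    label-<-antidiagonal⁻ : ∀ {a b a′ b′} → InR w e (a , b) → InR w e (a′ , b′) → a + b ≡ a′ + b′ →
      T e (a , b) < T e (a′ , b′) → a < a′
    label-<-antidiagonal⁻ R R′ eq lt = ≰⇒> λ a′≤a → <⇒≱ lt (label-≤-antidiagonal R′ R (sym eq) a′≤a)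

    label-≡-antidiagonal⁻ : ∀ {a b a′ b′} → InR w e (a , b) → InR w e (a′ , b′) → a + b ≡ a′ + b′ →
      T e (a , b) ≡ T e (a′ , b′) → a ≡ a′
    label-≡-antidiagonal⁻ R R′ eq T≡T with <-cmp _ _
    ... | tri< a<a′ _ _ = contradiction T≡T (<⇒≢ (label-<-antidiagonal R R′ eq a<a′))
    ... | tri≈ _ a≡a′ _ = a≡a′
    ... | tri> _ _ a′<a = contradiction (sym T≡T) (<⇒≢ (label-<-antidiagonal R′ R (sym eq) a′<a))

module _ {n : ℕ} (w : Permutation′ n) (T : Tableau) where

  update-at : ∀ p v → val w (update w T p v) p ≡ v
  update-at p v = cong (if_then v else val w T p) (dec-true (≡-dec (≡-dec _≟_ _≟_) (≡-dec _≟_ _≟_) p p) refl)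

  update-elsewhere : ∀ p v q → q ≢ p → val w (update w T p v) q ≡ val w T q
  update-elsewhere p v q q≢p =
    cong (if_then v else val w T q) (dec-false (≡-dec (≡-dec _≟_ _≟_) (≡-dec _≟_ _≟_) q p) q≢p)

module _ {n : ℕ} {w : Permutation′ n} (grassmannian : Grassmannian w) {k : ℕ} (descent : Descent w k) where

  private
    k≤n : k ≤ n
    k≤n = <⇒≤ (proj₁ (proj₂ descent))

    ascent : ∀ {t} → 1 ≤ t → suc t ≤ n → t ≢ k → app w t < app w (suc t)
    ascent {t} 1≤t 1+t≤n t≢k with <-cmp (app w t) (app w (suc t))
    ... | tri< w[t]<w[1+t] _ _ = w[t]<w[1+t]
    ... | tri≈ _ w[t]≡w[1+t] _ =
      contradiction (app-injective w 1≤t (<⇒≤ 1+t≤n) (s≤s z≤n) 1+t≤n w[t]≡w[1+t]) (1+n≢n ∘′ sym)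
    ... | tri> _ _ w[1+t]<w[t] = contradiction (grassmannian t k (1≤t , 1+t≤n , w[1+t]<w[t]) descent) t≢k

    left-ascent : ∀ {t} → 1 ≤ t → suc t ≤ k → app w t < app w (suc t)
    left-ascent 1≤t 1+t≤k = ascent 1≤t (≤-trans 1+t≤k k≤n) λ { refl → 1+n≰n 1+t≤k }

    right-ascent : ∀ {t} → suc k ≤ t → suc t ≤ n → app w t < app w (suc t)
    right-ascent k<t 1+t≤n = ascent (≤-trans (s≤s z≤n) k<t) 1+t≤n λ { refl → 1+n≰n k<t }

  app-+-mono-left : ∀ {s t} → 1 ≤ s → s ≤ t → t ≤ k → app w s + t ≤ app w t + s
  app-+-mono-left = ascents⇒+-mono (app w) left-ascent

  app-<-left : ∀ {s t} → 1 ≤ s → s < t → t ≤ k → app w s < app w t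
  app-<-left = ascents⇒< (app w) left-ascent

  app-≤-left : ∀ {s t} → 1 ≤ s → s ≤ t → t ≤ k → app w s ≤ app w t
  app-≤-left = ascents⇒≤ (app w) left-ascent

  app-<-right : ∀ {s t} → k < s → s < t → t ≤ n → app w s < app w t
  app-<-right = ascents⇒< (app w) right-ascent

  essential-row : ∀ {i j} → Ess w (i , j) → i ≡ k
  essential-row E = grassmannian _ k (essential⇒descent w E) descent

  ≤rank⇒app≤ : ∀ {t j} → 1 ≤ t → t ≤ rank w (k , j) → app w t ≤ j
  ≤rank⇒app≤ {suc t} {j} 1≤1+t 1+t≤r = ≮⇒≥ λ j<w[1+t] →
    1+n≰n (≤-trans 1+t≤r (length-filter-range-≤ (λ s → app w s ≤? j) (s≤t j<w[1+t])))
    where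
      s≤t : j < app w (suc t) → ∀ {s} → 1 ≤ s → s ≤ k → app w s ≤ j → s ≤ t
      s≤t j<w[1+t] 1≤s s≤k w[s]≤j = ≤-pred (≰⇒> λ 1+t≤s →
        <⇒≱ j<w[1+t] (≤-trans (app-≤-left 1≤1+t 1+t≤s s≤k) w[s]≤j))

  app≤⇒≤rank : ∀ {t j} → 1 ≤ t → t ≤ k → app w t ≤ j → t ≤ rank w (k , j)
  app≤⇒≤rank {t} {j} 1≤t t≤k w[t]≤j = length-filter-range-≥ (λ s → app w s ≤? j) t≤k
    λ 1≤s s≤t → ≤-trans (app-≤-left 1≤s s≤t t≤k) w[t]≤j

  -- λ(w) has w(a) − a boxes in row a ≤ k: see InR⇒InShape and InShape⇒InLambda.
  InShape : Box → Set
  InShape (a , b) = 1 ≤ a × a ≤ k × 1 ≤ b × a + b ≤ app w a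

  InShape? : ∀ x → Dec (InShape x)
  InShape? (a , b) = 1 ≤? a ×-dec a ≤? k ×-dec 1 ≤? b ×-dec a + b ≤? app w a

  InShape-antidiagonal : ∀ {a b a′ b′} → InShape (a , b) → a ≤ a′ → a′ ≤ k → 1 ≤ b′ → a′ + b′ ≡ a + b →
    InShape (a′ , b′)
  InShape-antidiagonal (1≤a , _ , _ , a+b≤w[a]) a≤a′ a′≤k 1≤b′ a′+b′≡a+b =
    ≤-trans 1≤a a≤a′ , a′≤k , 1≤b′ ,
    ≤-trans (≤-reflexive a′+b′≡a+b) (≤-trans a+b≤w[a] (app-≤-left 1≤a a≤a′ a′≤k))

  InR-downLeft : ∀ {e a b a′ b′} → Ess w e → InR w e (a , b) → a ≤ a′ → a′ ≤ k → 1 ≤ b′ → b′ ≤ b →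
    InR w e (a′ , b′)
  InR-downLeft {i , j} E (r<a , _ , _ , b≤j∸r) a≤a′ a′≤k 1≤b′ b′≤b with essential-row E
  ... | refl = <-≤-trans r<a a≤a′ , a′≤k , 1≤b′ , ≤-trans b′≤b b≤j∸r

  InLambda-down : ∀ {a b a′} → InLambda w (a , b) → a ≤ a′ → a′ ≤ k → InLambda w (a′ , b)
  InLambda-down (e , E , R@(_ , _ , 1≤b , _)) a≤a′ a′≤k = e , E , InR-downLeft E R a≤a′ a′≤k 1≤b ≤-refl

  InR⇒InShape : ∀ {e a b} → Ess w e → InR w e (a , b) → InShape (a , b)
  InR⇒InShape {i , j} {a} {b} E (r<a , a≤i , 1≤b , b≤j∸r) with essential-row E
  ... | refl = ≤-trans (s≤s z≤n) r<a , a≤i , 1≤b , +-cancelʳ-≤ r (a + b) (app w a) (≤-pred a+b+r<1+w[a]+r)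
    where
      open ≤-Reasoning
      r : ℕ
      r = rank w (k , j)
      j<w[1+r] : j < app w (suc r)
      j<w[1+r] = ≰⇒> λ w[1+r]≤j → 1+n≰n (app≤⇒≤rank (s≤s z≤n) (≤-trans r<a a≤i) w[1+r]≤j)
      a+b+r<1+w[a]+r : a + b + r < suc (app w a + r)
      a+b+r<1+w[a]+r = begin-strict
        a + b + r         ≡⟨ +-assoc a b r ⟩
        a + (b + r)       ≤⟨ +-monoʳ-≤ a (≤∸⇒+≤ 1≤b b≤j∸r) ⟩
        a + j             ≡⟨ +-comm a j ⟩
        j + a             <⟨ +-monoˡ-< a j<w[1+r] ⟩
        app w (suc r) + a ≤⟨ app-+-mono-left (s≤s z≤n) r<a a≤i ⟩
        app w a + suc r   ≡⟨ +-suc (app w a) r ⟩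
        suc (app w a + r) ∎

  corner-outside-shape : ∀ {j} → rank w (k , j) ≤ j → ¬ InShape (rank w (k , j) , suc (j ∸ rank w (k , j)))
  corner-outside-shape {j} r≤j (1≤r , _ , _ , r+1+[j∸r]≤w[r]) = 1+n≰n (begin
    suc j             ≡⟨ cong suc (sym (m+[n∸m]≡n r≤j)) ⟩
    suc (r + (j ∸ r)) ≡⟨ sym (+-suc r (j ∸ r)) ⟩
    r + suc (j ∸ r)   ≤⟨ r+1+[j∸r]≤w[r] ⟩
    app w r           ≤⟨ ≤rank⇒app≤ 1≤r ≤-refl ⟩
    j                 ∎)
    where
      open ≤-Reasoning
      r : ℕ
      r = rank w (k , j)

  private
    essential-at : ∀ {a j} → 1 ≤ a → a ≤ k → 1 ≤ j → app w a ≡ suc j →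
      (∀ {t} → 1 ≤ t → t < a → app w t ≢ j) → Ess w (k , j)
    essential-at {a} {j} 1≤a a≤k 1≤j w[a]≡1+j fresh =
      (j<w[k] , k<w⁻¹[j]) ,
      (λ (j<w[1+k] , 1+k<w⁻¹[j]) → <-asym j<w[1+k] (w[1+k]<j 1+k<w⁻¹[j])) ,
      (λ (_ , k<w⁻¹[1+j]) → <⇒≱ k<w⁻¹[1+j] (subst (_≤ k) (sym w⁻¹[1+j]≡a) a≤k))
      where
        j≤n : j ≤ n
        j≤n = <⇒≤ (subst (_≤ n) w[a]≡1+j (app≤n w a))
        t : ℕ
        t = appInv w j
        t∈[1,n] : 1 ≤ t × t ≤ n
        t∈[1,n] = appInv-bounded w 1≤j j≤n
        w[t]≡j : app w t ≡ j
        w[t]≡j = app-appInv w 1≤j j≤n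
        j<w[k] : j < app w k
        j<w[k] = subst (_≤ app w k) w[a]≡1+j (app-≤-left 1≤a a≤k ≤-refl)
        k<w⁻¹[j] : k < t
        k<w⁻¹[j] = ≰⇒> λ t≤k → case t <? a of λ where
          (yes t<a) → fresh (proj₁ t∈[1,n]) t<a w[t]≡j
          (no  t≮a) → 1+n≰n (subst₂ _≤_ w[a]≡1+j w[t]≡j (app-≤-left 1≤a (≮⇒≥ t≮a) t≤k))
        w[1+k]<j : suc k < t → app w (suc k) < j
        w[1+k]<j 1+k<t = subst (app w (suc k) <_) w[t]≡j (app-<-right ≤-refl 1+k<t (proj₂ t∈[1,n]))
        w⁻¹[1+j]≡a : appInv w (suc j) ≡ a
        w⁻¹[1+j]≡a = trans (cong (appInv w) (sym w[a]≡1+j)) (appInv-app w 1≤a (≤-trans a≤k k≤n))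

    InLambda-at : ∀ {a b j} → InShape (a , b) → app w a ≡ suc j →
      (∀ {t} → 1 ≤ t → t < a → app w t ≢ j) → InLambda w (a , b)
    InLambda-at {a} {b} {j} (1≤a , a≤k , 1≤b , a+b≤w[a]) w[a]≡1+j fresh =
      (k , j) , essential-at 1≤a a≤k 1≤j w[a]≡1+j fresh , r<a , a≤k , 1≤b , m+n≤o⇒m≤o∸n b b+r≤j
      where
        open ≤-Reasoning
        r : ℕ
        r = rank w (k , j)
        a+b≤1+j : a + b ≤ suc j
        a+b≤1+j = subst (a + b ≤_) w[a]≡1+j a+b≤w[a]
        1≤j : 1 ≤ j
        1≤j = ≤-pred (≤-trans (+-mono-≤ 1≤a 1≤b) a+b≤1+j)
        r<a : r < a
        r<a = ≰⇒> λ a≤r → 1+n≰n (subst (_≤ j) w[a]≡1+j (≤rank⇒app≤ 1≤a a≤r))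
        b+r≤j : b + r ≤ j
        b+r≤j = ≤-pred (begin
          suc (b + r) ≡⟨ sym (+-suc b r) ⟩
          b + suc r   ≤⟨ +-monoʳ-≤ b r<a ⟩
          b + a       ≡⟨ +-comm b a ⟩
          a + b       ≤⟨ a+b≤1+j ⟩
          suc j       ∎)

    app≡1+pred : ∀ {a b} → InShape (a , b) → app w a ≡ suc (pred (app w a))
    app≡1+pred {a} (1≤a , _ , _ , a+b≤w[a]) =
      sym (suc-pred (app w a) {{>-nonZero (≤-trans 1≤a (≤-trans (m≤m+n a _) a+b≤w[a]))}})

    InShape-previous-row : ∀ {a b} → InShape (suc (suc a) , b) → app w (suc a) ≡ pred (app w (suc (suc a))) →
      InShape (suc a , b)
    InShape-previous-row {a} {b} (_ , 2+a≤k , 1≤b , 2+a+b≤w[2+a]) w[1+a]≡j =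
      s≤s z≤n , <⇒≤ 2+a≤k , 1≤b , subst (suc a + b ≤_) (sym w[1+a]≡j) (<⇒≤pred 2+a+b≤w[2+a])

  -- If a₀ ≤ a is least such that w(a₀), …, w(a) are consecutive integers, then (k, w(a₀) − 1) is
  -- essential with rank a₀ − 1, and its rectangle contains (a, b).
  InShape⇒InLambda : ∀ {a b} → InShape (a , b) → InLambda w (a , b)
  InShape⇒InLambda {suc a} = from-row a
    where
      from-row : ∀ a {b} → InShape (suc a , b) → InLambda w (suc a , b)
      from-row zero    S = InLambda-at S (app≡1+pred S) λ { 1≤t (s≤s t≤0) → contradiction (≤-trans 1≤t t≤0) λ () }
      from-row (suc a) S@(_ , 2+a≤k , _ , _) with app w (suc a) ≟ pred (app w (suc (suc a)))
      ... | yes w[1+a]≡j = InLambda-down (from-row a (InShape-previous-row S w[1+a]≡j)) (n≤1+n _) 2+a≤k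
      ... | no  w[1+a]≢j = InLambda-at S (app≡1+pred S) fresh
        where
          w[1+a]≤j : app w (suc a) ≤ pred (app w (suc (suc a)))
          w[1+a]≤j = <⇒≤pred (app-<-left (s≤s z≤n) ≤-refl 2+a≤k)
          fresh : ∀ {t} → 1 ≤ t → t < suc (suc a) → app w t ≢ pred (app w (suc (suc a)))
          fresh 1≤t t<2+a w[t]≡j = w[1+a]≢j (≤-antisym w[1+a]≤j
            (subst (_≤ app w (suc a)) w[t]≡j (app-≤-left 1≤t (≤-pred t<2+a) (<⇒≤ 2+a≤k))))

  -- The rows a whose box (a, i + 1 − a) on the i-th antidiagonal (in the indexing of d) lies in λ(w).
  antidiagonalRows : ℕ → List ℕ
  antidiagonalRows i = filter (λ a → InShape? (a , suc i ∸ a)) (range n)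

  antidiagonalSize : ℕ → ℕ
  antidiagonalSize i = length (antidiagonalRows i)

  ∈-antidiagonalRows⁻ : ∀ {i a} → a ∈ antidiagonalRows i → InShape (a , suc i ∸ a) × a + (suc i ∸ a) ≡ suc i
  ∈-antidiagonalRows⁻ {i} {a} a∈ with ∈-filter⁻ (λ a → InShape? (a , suc i ∸ a)) {xs = range n} a∈
  ... | _ , S@(_ , _ , 1≤b , _) =
    S , m+[n∸m]≡n {a} (<⇒≤ (m∸n≢0⇒n<m λ b≡0 → contradiction (subst (1 ≤_) b≡0 1≤b) λ ()))

  private
    inversionsFrom : ℕ → List ℕ
    inversionsFrom a = filter (λ y → inv? w (a , y)) (range n)

    antidiagonalsThrough : ℕ → List ℕ
    antidiagonalsThrough a = filter (λ i → InShape? (a , suc i ∸ a)) (range n)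

    -- The positions 1, …, a and the inversions (a, y) are distinct and all carry values ≤ w(a).
    inversionsFrom≤ : ∀ {a} → 1 ≤ a → a ≤ k → a + length (inversionsFrom a) ≤ app w a
    inversionsFrom≤ {a} 1≤a a≤k =
      subst₂ _≤_ (trans (length-++ (range a)) (cong (_+ length (inversionsFrom a)) (length-range a)))
                 (trans (length-map (appInv w) (range (app w a))) (length-range (app w a)))
        (Unique-⊆⇒length≤ _≟_ (Unique.++⁺ (range-Unique a) (Unique.filter⁺ _ (range-Unique n)) disjoint)
          ⊆positions≤w[a])
      where
        position≤w[a] : ∀ {t} → 1 ≤ t → t ≤ n → app w t ≤ app w a → t ∈ map (appInv w) (range (app w a))
        position≤w[a] 1≤t t≤n w[t]≤w[a] = subst (_∈ _) (appInv-app w 1≤t t≤n)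
          (∈-map⁺ (appInv w) (∈-range⁺ (proj₁ (app-bounded w 1≤t t≤n)) w[t]≤w[a]))
        ⊆positions≤w[a] : range a ++ inversionsFrom a ⊆ map (appInv w) (range (app w a))
        ⊆positions≤w[a] t∈ with ∈-++⁻ (range a) t∈
        ... | inj₁ t∈[1,a] = let 1≤t , t≤a = ∈-range⁻ t∈[1,a] in
          position≤w[a] 1≤t (≤-trans t≤a (≤-trans a≤k k≤n)) (app-≤-left 1≤t t≤a a≤k)
        ... | inj₂ t∈inv = let t∈[1,n] , _ , w[t]<w[a] = ∈-filter⁻ (λ y → inv? w (a , y)) {xs = range n} t∈inv
                               1≤t , t≤n = ∈-range⁻ t∈[1,n] in
          position≤w[a] 1≤t t≤n (<⇒≤ w[t]<w[a])
        disjoint : Disjoint (range a) (inversionsFrom a)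
        disjoint (t∈[1,a] , t∈inv) =
          <⇒≱ (proj₁ (proj₂ (∈-filter⁻ (λ y → inv? w (a , y)) {xs = range n} t∈inv))) (proj₂ (∈-range⁻ t∈[1,a]))

    antidiagonalsThrough≥ : ∀ {a} → 1 ≤ a → a ≤ k → app w a ∸ a ≤ length (antidiagonalsThrough a)
    antidiagonalsThrough≥ {a} 1≤a a≤k =
      subst (_≤ length (antidiagonalsThrough a)) (trans (length-map (a +_) (upTo (app w a ∸ a))) (length-upTo _))
        (Unique-⊆⇒length≤ _≟_ (Unique.map⁺ (+-cancelˡ-≡ a _ _) (Unique.upTo⁺ _)) ⊆antidiagonalsThrough)
      where
        ⊆antidiagonalsThrough : map (a +_) (upTo (app w a ∸ a)) ⊆ antidiagonalsThrough a
        ⊆antidiagonalsThrough i∈ with ∈-map⁻ (a +_) i∈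
        ... | d , d∈ , refl =
          ∈-filter⁺ (λ i → InShape? (a , suc i ∸ a))
            (∈-range⁺ (≤-trans 1≤a (m≤m+n a d)) (≤-trans (<⇒≤ a+d<w[a]) (app≤n w a)))
            (subst (λ b → InShape (a , b)) (sym 1+a+d∸a≡1+d) (1≤a , a≤k , s≤s z≤n , a+1+d≤w[a]))
          where
            a+1+d≤w[a] : a + suc d ≤ app w a
            a+1+d≤w[a] = subst (_≤ app w a) (+-comm (suc d) a) (≤∸⇒+≤ (s≤s z≤n) (∈-upTo⁻ d∈))
            a+d<w[a] : a + d < app w a
            a+d<w[a] = subst (_≤ app w a) (+-suc a d) a+1+d≤w[a]
            1+a+d∸a≡1+d : suc (a + d) ∸ a ≡ suc d
            1+a+d∸a≡1+d = trans (cong (_∸ a) (sym (+-suc a d))) (m+n∸m≡n a (suc d))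

    inversionsFrom≤antidiagonalsThrough : ∀ {a} → a ∈ range n →
      length (inversionsFrom a) ≤ length (antidiagonalsThrough a)
    inversionsFrom≤antidiagonalsThrough {a} a∈ with ≤-<-connex a k
    ... | inj₁ a≤k = let 1≤a , _ = ∈-range⁻ a∈ in
      ≤-trans (m+n≤o⇒m≤o∸n _ (subst (_≤ app w a) (+-comm a _) (inversionsFrom≤ 1≤a a≤k)))
              (antidiagonalsThrough≥ 1≤a a≤k)
    ... | inj₂ k<a = ≤-trans (length-filter-range-≤ (λ y → inv? w (a , y)) {m = 0}
      λ _ y≤n (a<y , w[y]<w[a]) → contradiction w[y]<w[a] (<⇒≯ (app-<-right k<a a<y y≤n))) z≤n

  length≤sum-antidiagonalSize : len w ≤ sum (map antidiagonalSize (range n))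
  length≤sum-antidiagonalSize = begin
    len w
      ≡⟨ length-filter-cartesianProduct (inv? w) (range n) (range n) ⟩
    sum (map (λ a → length (inversionsFrom a)) (range n))
      ≤⟨ sum-map-mono-≤ _ _ (range n) inversionsFrom≤antidiagonalsThrough ⟩
    sum (map (λ a → length (antidiagonalsThrough a)) (range n))
      ≡⟨ sum-length-filter-comm (λ a i → InShape? (a , suc i ∸ a)) (range n) (range n) ⟩
    sum (map antidiagonalSize (range n))
      ∎
    where open ≤-Reasoning

  record AntidiagonalCover (s : ℕ) : Set where
    field
      color     : Color
      essential : Ess w color
      covers    : ∀ {a b} → InShape (a , b) → a + b ≡ s → InR w color (a , b)

  open AntidiagonalCover

  private
    cover-from-topmost : ∀ {a b} → InShape (a , b) →
      (∀ {a′ b′} → InShape (a′ , b′) → a′ + b′ ≡ a + b → a ≤ a′) → AntidiagonalCover (a + b)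
    cover-from-topmost S topmost with InShape⇒InLambda S
    ... | e , E , R = record
      { color     = e
      ; essential = E
      ; covers    = λ S′@(_ , a′≤k , 1≤b′ , _) a′+b′≡a+b → let a≤a′ = topmost S′ a′+b′≡a+b in
                      InR-downLeft E R a≤a′ a′≤k 1≤b′ (+≡+∧≤⇒≥ (sym a′+b′≡a+b) a≤a′)
      }

  cover : ∀ {a b} → InShape (a , b) → AntidiagonalCover (a + b)
  cover {suc a} = from-row a
    where
      from-row : ∀ a {b} → InShape (suc a , b) → AntidiagonalCover (suc a + b)
      from-row zero    S = cover-from-topmost S λ S′ _ → proj₁ S′
      from-row (suc a) {b} S@(_ , 2+a≤k , _ , _) with InShape? (suc a , suc b)
      ... | yes S↗ = subst AntidiagonalCover (+-suc (suc a) b) (from-row a S↗)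
      ... | no  ¬S↗ = cover-from-topmost S λ S′ a′+b′≡2+a+b → ≰⇒> λ a′≤1+a →
        ¬S↗ (InShape-antidiagonal S′ a′≤1+a (<⇒≤ 2+a≤k) (s≤s z≤n) (trans (+-suc (suc a) b) (sym a′+b′≡2+a+b)))

  module _ {T : Tableau} (prism : IsPrism w T) where

    private
      coverLabels : ∀ {i} → AntidiagonalCover (suc i) → List ℕ
      coverLabels {i} C = map (λ a → T (color C) (a , suc i ∸ a)) (antidiagonalRows i)

      coverLabels-Unique : ∀ {i} (C : AntidiagonalCover (suc i)) → Unique (coverLabels C)
      coverLabels-Unique {i} C = Unique-map-injectiveOn _
        (λ a∈ a′∈ → label-≡-antidiagonal⁻ prism (essential C) (covered a∈) (covered a′∈)
                      (trans (proj₂ (∈-antidiagonalRows⁻ a∈)) (sym (proj₂ (∈-antidiagonalRows⁻ a′∈)))))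
        (Unique.filter⁺ _ (range-Unique n))
        where
          covered : ∀ {a} → a ∈ antidiagonalRows i → InR w (color C) (a , suc i ∸ a)
          covered a∈ = covers C (proj₁ (∈-antidiagonalRows⁻ a∈)) (proj₂ (∈-antidiagonalRows⁻ a∈))

      coverLabels⊆antiLabels : ∀ {i} (C : AntidiagonalCover (suc i)) → coverLabels C ⊆ antiLabels w T i
      coverLabels⊆antiLabels C v∈ with ∈-map⁻ _ v∈
      ... | a , a∈ , refl = let S , a+b≡1+i = ∈-antidiagonalRows⁻ a∈ in
        label∈antiLabels T (essential C) (covers C S a+b≡1+i) a+b≡1+i

      antidiagonalSize≤d-covered : ∀ {i} → AntidiagonalCover (suc i) → antidiagonalSize i ≤ d w T i
      antidiagonalSize≤d-covered {i} C = subst (_≤ d w T i) (length-map _ (antidiagonalRows i))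
        (Unique-⊆⇒length≤ _≟_ (coverLabels-Unique C) (∈-deduplicate⁺ _≟_ ∘′ coverLabels⊆antiLabels C))

    antidiagonalSize≤d : ∀ i → antidiagonalSize i ≤ d w T i
    antidiagonalSize≤d i with antidiagonalRows i in rows≡
    ... | []    = z≤n
    ... | a ∷ _ = let S , a+b≡1+i = ∈-antidiagonalRows⁻ (subst (a ∈_) (sym rows≡) (here refl)) in
      subst (λ rows → length rows ≤ d w T i) rows≡
        (antidiagonalSize≤d-covered (subst AntidiagonalCover a+b≡1+i (cover S)))

    module _ (minimal : IsMinimal w T) where

      antidiagonalSize≡d : ∀ {i} → i ∈ range n → antidiagonalSize i ≡ d w T i
      antidiagonalSize≡d = sum-map-≥⇒pointwise-≡ antidiagonalSize (d w T) (range n) (λ _ → antidiagonalSize≤d _)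
        (≤-trans (≤-reflexive minimal) length≤sum-antidiagonalSize)

      label-occurs-in-cover : ∀ {s e a b} (C : AntidiagonalCover s) → Ess w e → InR w e (a , b) → a + b ≡ s →
        ∃[ a′ ] ∃[ b′ ] InShape (a′ , b′) × a′ + b′ ≡ s × T e (a , b) ≡ T (color C) (a′ , b′)
      label-occurs-in-cover {suc i} {e} {suc a} {b} C E R 1+a+b≡1+i
        with ∈-map⁻ _ (antiLabels⊆coverLabels (∈-deduplicate⁺ _≟_ (label∈antiLabels T E R 1+a+b≡1+i)))
        where
          S : InShape (suc a , b)
          S = InR⇒InShape E R
          i∈[1,n] : i ∈ range n
          i∈[1,n] = ∈-range⁺
            (≤-trans (proj₁ (proj₂ (proj₂ S))) (≤-trans (m≤n+m b a) (≤-reflexive (suc-injective 1+a+b≡1+i))))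
            (<⇒≤ (≤-trans (≤-reflexive (sym 1+a+b≡1+i)) (≤-trans (proj₂ (proj₂ (proj₂ S))) (app≤n w (suc a)))))
          antiLabels⊆coverLabels : deduplicate _≟_ (antiLabels w T i) ⊆ coverLabels C
          antiLabels⊆coverLabels = Unique-⊆-length≥⇒⊇ _≟_ (coverLabels-Unique C)
            (∈-deduplicate⁺ _≟_ ∘′ coverLabels⊆antiLabels C)
            (≤-reflexive (trans (sym (antidiagonalSize≡d i∈[1,n])) (sym (length-map _ (antidiagonalRows i)))))
      ... | a′ , a′∈ , label≡ = let S′ , a′+b′≡1+i = ∈-antidiagonalRows⁻ a′∈ in a′ , _ , S′ , a′+b′≡1+i , label≡

      label≤cover : ∀ {s e a b} (C : AntidiagonalCover s) → Ess w e → InR w e (a , b) → a + b ≡ s →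
        T e (a , b) ≤ T (color C) (a , b)
      label≤cover {s} {e} {a} {suc b} C E R a+1+b≡s with label-occurs-in-cover C E R a+1+b≡s
      ... | a′ , b′ , S′ , a′+b′≡s , label≡ with a′ ≤? a
      ...   | yes a′≤a = subst (_≤ T (color C) (a , suc b)) (sym label≡)
        (label-≤-antidiagonal prism (essential C) (covers C S′ a′+b′≡s) (covers C (InR⇒InShape E R) a+1+b≡s)
          (trans a′+b′≡s (sym a+1+b≡s)) a′≤a)
      ...   | no  a′≰a = contradiction label≡ (<⇒≢ (begin-strict
        T e (a , suc b)         <⟨ label-antidiagonal-step prism E R R↓ ⟩
        T e (suc a , b)         ≤⟨ label≤cover C E R↓ 1+a+b≡s ⟩
        T (color C) (suc a , b) ≤⟨ label-≤-antidiagonal prism (essential C) (covers C (InR⇒InShape E R↓) 1+a+b≡s)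
                                     (covers C S′ a′+b′≡s) (trans 1+a+b≡s (sym a′+b′≡s)) a<a′ ⟩
        T (color C) (a′ , b′)   ∎))
        where
          open ≤-Reasoning
          a<a′ : a < a′
          a<a′ = ≰⇒> a′≰a
          1+a+b≡s : suc a + b ≡ s
          1+a+b≡s = trans (sym (+-suc a b)) a+1+b≡s
          R↓ : InR w e (suc a , b)
          R↓ = InR-downLeft E R (n≤1+n a) (≤-trans a<a′ (proj₁ (proj₂ S′)))
                 (≤-trans (proj₁ (proj₂ (proj₂ S′))) (+≡+∧≤⇒≥ (trans 1+a+b≡s (sym a′+b′≡s)) a<a′)) (n≤1+n b)

      private
        label<cover⇒above : ∀ {s e a b} (C : AntidiagonalCover s) → Ess w e → InR w e (suc a , b) →
          suc a + b ≡ s → T e (suc a , b) < T (color C) (suc a , b) →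
          InShape (a , suc b) × T e (suc a , b) ≤ T (color C) (a , suc b)
        label<cover⇒above {s} {e} {a} {b} C E R 1+a+b≡s e<g with label-occurs-in-cover C E R 1+a+b≡s
        ... | a′ , b′ , S′ , a′+b′≡s , label≡ = S↗ , subst (_≤ T (color C) (a , suc b)) (sym label≡)
          (label-≤-antidiagonal prism (essential C) (covers C S′ a′+b′≡s) (covers C S↗ a+1+b≡s)
            (trans a′+b′≡s (sym a+1+b≡s)) a′≤a)
          where
            a+1+b≡s : a + suc b ≡ s
            a+1+b≡s = trans (+-suc a b) 1+a+b≡s
            a′≤a : a′ ≤ a
            a′≤a = ≤-pred (label-<-antidiagonal⁻ prism (essential C) (covers C S′ a′+b′≡s)
              (covers C (InR⇒InShape E R) 1+a+b≡s) (trans a′+b′≡s (sym 1+a+b≡s))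
              (subst (_< T (color C) (suc a , b)) label≡ e<g))
            S↗ : InShape (a , suc b)
            S↗ = InShape-antidiagonal S′ a′≤a (<⇒≤ (proj₁ (proj₂ (InR⇒InShape E R)))) (s≤s z≤n)
                   (trans a+1+b≡s (sym a′+b′≡s))

        cover↗<label-from-above : ∀ {s e a b} (C : AntidiagonalCover s) (C↑ : AntidiagonalCover (a + b)) →
          Ess w e → InR w e (a , b) → InR w e (suc a , b) → InR w (color C) (a , suc b) →
          T (color C↑) (a , b) ≤ T e (a , b) → T (color C) (a , suc b) < T e (suc a , b)
        cover↗<label-from-above {a = a} {b} C C↑ E R↑ R Rg↗ C↑≤e = begin-strict
          T (color C) (a , suc b) ≤⟨ label-≤-row prism (essential C) Rg↑ Rg↗ ⟩
          T (color C) (a , b)     ≤⟨ label≤cover C↑ (essential C) Rg↑ refl ⟩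
          T (color C↑) (a , b)    ≤⟨ C↑≤e ⟩
          T _ (a , b)             <⟨ label-<-column prism E R↑ R ⟩
          T _ (suc a , b)         ∎
          where
            open ≤-Reasoning
            Rg↑ : InR w (color C) (a , b)
            Rg↑ = InR-downLeft (essential C) Rg↗ ≤-refl (<⇒≤ (proj₁ (proj₂ (InR⇒InShape E R))))
                    (proj₁ (proj₂ (proj₂ R↑))) (n≤1+n b)

        cover↗<label-from-right : ∀ {s e a b} (C : AntidiagonalCover s) (C→ : AntidiagonalCover (suc a + suc b)) →
          Ess w e → InR w e (suc a , b) → InR w e (suc a , suc b) → InR w (color C) (a , suc b) →
          T (color C→) (suc a , suc b) ≤ T e (suc a , suc b) → T (color C) (a , suc b) < T e (suc a , b)
        cover↗<label-from-right {a = a} {b} C C→ E R R→ Rg↗ C→≤e = begin-strict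
          T (color C) (a , suc b)      <⟨ label-<-column prism (essential C) Rg↗ Rg→ ⟩
          T (color C) (suc a , suc b)  ≤⟨ label≤cover C→ (essential C) Rg→ refl ⟩
          T (color C→) (suc a , suc b) ≤⟨ C→≤e ⟩
          T _ (suc a , suc b)          ≤⟨ label-≤-row prism E R R→ ⟩
          T _ (suc a , b)              ∎
          where
            open ≤-Reasoning
            Rg→ : InR w (color C) (suc a , suc b)
            Rg→ = InR-downLeft (essential C) Rg↗ (n≤1+n a) (proj₁ (proj₂ (InR⇒InShape E R))) (s≤s z≤n) ≤-refl

        distanceToCorner : Color → Box → ℕ
        distanceToCorner e (a , b) = (a ∸ suc (rank w e)) + ((proj₂ e ∸ rank w e) ∸ b)

      -- A label below the covering one reappears as a covering label up and to the right
      -- (label<cover⇒above), which is impossible by the hypothesis for the box above or, in the top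
      -- row of R_e, for the box to the right; both are closer to the top-right corner of R_e.
      cover≤label : ∀ {s e a b} (C : AntidiagonalCover s) → Ess w e → InR w e (a , b) → a + b ≡ s →
        T (color C) (a , b) ≤ T e (a , b)
      cover≤label = go (<-wellFounded _)
        where
          go : ∀ {s e a b} → Acc _<_ (distanceToCorner e (a , b)) → (C : AntidiagonalCover s) → Ess w e →
            InR w e (a , b) → a + b ≡ s → T (color C) (a , b) ≤ T e (a , b)
          go {s} {i , j} {suc a} {b} (acc closer) C E R@(r<1+a , 1+a≤k , 1≤b , b≤c) 1+a+b≡s with essential-row E
          ... | refl = ≮⇒≥ λ e<g → let S↗ , e≤g↗ = label<cover⇒above C E R 1+a+b≡s e<g in
            <⇒≱ (cover↗<label S↗) e≤g↗
            where
              r : ℕ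
              r = rank w (k , j)
              c : ℕ
              c = j ∸ r
              covered↗ : InShape (a , suc b) → InR w (color C) (a , suc b)
              covered↗ S↗ = covers C S↗ (trans (+-suc a b) 1+a+b≡s)
              cover↗<label : InShape (a , suc b) → T (color C) (a , suc b) < T (k , j) (suc a , b)
              cover↗<label S↗ with suc r ≤? a | suc b ≤? c
              ... | yes r<a | _ =
                cover↗<label-from-above C C↑ E R↑ R (covered↗ S↗)
                  (go (closer (+-monoˡ-< (c ∸ b) (∸-monoˡ-< (n<1+n a) r<a))) C↑ E R↑ refl)
                where
                  R↑ : InR w (k , j) (a , b)
                  R↑ = r<a , <⇒≤ 1+a≤k , 1≤b , b≤c
                  C↑ : AntidiagonalCover (a + b)
                  C↑ = cover (InR⇒InShape E R↑)
              ... | no _ | yes 1+b≤c =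
                cover↗<label-from-right C C→ E R R→ (covered↗ S↗)
                  (go (closer (+-monoʳ-< (a ∸ r) (∸-monoʳ-< (n<1+n b) 1+b≤c))) C→ E R→ refl)
                where
                  R→ : InR w (k , j) (suc a , suc b)
                  R→ = r<1+a , 1+a≤k , s≤s z≤n , 1+b≤c
                  C→ : AntidiagonalCover (suc a + suc b)
                  C→ = cover (InR⇒InShape E R→)
              ... | no r≮a | no 1+b≰c = contradiction (subst₂ (λ a b → InShape (a , suc b)) a≡r b≡c S↗)
                (corner-outside-shape (m+n≤o⇒n≤o b (≤∸⇒+≤ 1≤b b≤c)))
                where
                  a≡r : a ≡ r
                  a≡r = ≤-antisym (≤-pred (≰⇒> r≮a)) (≤-pred r<1+a)
                  b≡c : b ≡ c
                  b≡c = ≤-antisym b≤c (≤-pred (≰⇒> 1+b≰c))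

      label≡cover : ∀ {s e a b} (C : AntidiagonalCover s) → Ess w e → InR w e (a , b) → a + b ≡ s →
        T e (a , b) ≡ T (color C) (a , b)
      label≡cover C E R a+b≡s = ≤-antisym (label≤cover C E R a+b≡s) (cover≤label C E R a+b≡s)

      sameValuesInBoxes : SameValuesInBoxes w T
      sameValuesInBoxes e e′ (a , b) E E′ R R′ =
        trans (label≡cover C E R refl) (sym (label≡cover C E′ R′ refl))
        where
          C : AntidiagonalCover (a + b)
          C = cover (InR⇒InShape E R)

      noUnstableTriple : ¬ HasUnstableTriple w T
      noUnstableTriple ((c , (a , b)) , _ , (e , (a′ , b′)) , (Ec , Rc) , _ , (Ee , Re) , _ , _ , _ , _ ,
                        a+b≡a′+b′ , _ , c<e , raised-prism) =
        <-irrefl (trans (label≡cover C Ee Re a′+b′≡a+b) (sym (label≡cover C Ec Rc′ a′+b′≡a+b)))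
          (subst₂ _<_ (update-at w T (c , (a , b)) _)
                      (update-elsewhere w T (c , (a , b)) _ (c , (a′ , b′)) a′b′≢ab)
            (label-<-antidiagonal raised-prism Ec Rc Rc′ a+b≡a′+b′ a<a′))
        where
          C : AntidiagonalCover (a + b)
          C = cover (InR⇒InShape Ec Rc)
          a′+b′≡a+b : a′ + b′ ≡ a + b
          a′+b′≡a+b = sym a+b≡a′+b′
          a<a′ : a < a′
          a<a′ = label-<-antidiagonal⁻ prism (essential C) (covers C (InR⇒InShape Ec Rc) refl)
            (covers C (InR⇒InShape Ee Re) a′+b′≡a+b) a+b≡a′+b′
            (subst₂ _<_ (label≡cover C Ec Rc refl) (label≡cover C Ee Re a′+b′≡a+b) c<e)
          Rc′ : InR w c (a′ , b′)
          Rc′ = InR-downLeft Ec Rc (<⇒≤ a<a′) (proj₁ (proj₂ (InR⇒InShape Ee Re))) (proj₁ (proj₂ (proj₂ Re)))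
                  (+≡+∧≤⇒≥ a+b≡a′+b′ (<⇒≤ a<a′))
          a′b′≢ab : (c , (a′ , b′)) ≢ (c , (a , b))
          a′b′≢ab refl = <-irrefl refl a<a′

proposition4p1 : (n : ℕ) (w : Permutation′ n) → Grassmannian w →
    FrenchYoung (InLambda w)
  × (∀ T → MinimalPrism w T → SameValuesInBoxes w T)
  × (∀ T → MinimalPrism w T → ¬ HasUnstableTriple w T)
  × (∀ T → MinimalPrism w T → InPrism w T)
proposition4p1 n w grassmannian =
  InLambda-frenchYoung grassmannian , sameValues , noUnstable ,
  λ T minimalPrism → minimalPrism , noUnstable T minimalPrism
  where
    sameValues : ∀ T → MinimalPrism w T → SameValuesInBoxes w T
    sameValues T (prism , minimal) e e′ x E =
      sameValuesInBoxes grassmannian (essential⇒descent w E) prism minimal e e′ x E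
    noUnstable : ∀ T → MinimalPrism w T → ¬ HasUnstableTriple w T
    noUnstable T (prism , minimal) triple@(_ , _ , _ , (E , _) , _) =
      noUnstableTriple grassmannian (essential⇒descent w E) prism minimal triple
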